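{- For any pointed graph $(X,x_0)$, the map $p\colon(\tilde X_{x_0},[c_{x_0}])\to(X,x_0)$ is a universal cover.
   Context: Graphs are simple undirected loopless graphs; graph maps send adjacent vertices to equal or adjacent vertices. $I_n$ has vertices $0,\dots,n$, edges $i\sim i+1$; a path of length $n$ from $x$ to $x'$ is a graph map $\gamma\colon I_n\to X$ with $\gamma(0)=x,\gamma(n)=x'$; $c_{x_0}$ is the constant path at $x_0$; $\ast$ is concatenation. The path-homotopy class $[\gamma]$ of $\gamma$ is its path-component in the quotient of $\coprod_nP_nX(x,x')$ by reparametrization $\gamma\sim\gamma\circ s$ along surjective order-preserving graph maps $s\colon I_m\to I_n$ ($P_nX(x,x')$: paths of length $n$, adjacent iff distinct and pointwise equal-or-adjacent). The graph $\tilde X_{x_0}$ has as vertices the classes $[\gamma]$ of finite paths $\gamma$ starting at $x_0$ (with arbitrary endpoint), and edges $[\gamma]\sim[\gamma\ast e]$ for every such $\gamma$ and every non-constant path $e$ of length $1$ starting at the endpoint of $\gamma$; $p([\gamma])$ is the endpoint of $\gamma$. A graph map $q\colon Y\to X$ is a covering map if (i) for every vertex $y$, $q$ restricts to a bijection from $y$ together with its neighbours onto $q(y)$ together with its neighbours, and (ii) for all graph maps $u\colon I_3\to Y$, $v\colon I_1\square I_1\to X$ ($I_1\square I_1$ the $4$-cycle on $\{0,1\}^2$) with $q(u(0))=v(1,0)$, $q(u(1))=v(0,0)$, $q(u(2))=v(0,1)$, $q(u(3))=v(1,1)$, one has $u(0)=u(3)$ or $u(0)\sim u(3)$. A pointed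 covering of $(X,x_0)$ is a base-point preserving covering map; $\mathsf{Cov}(X,x_0)$ has these as objects and base-point preserving graph maps over $X$ as morphisms; a universal cover is an initial object of $\mathsf{Cov}(X,x_0)$. -}

module Defs where

open import Level using (Level; _⊔_; 0ℓ) renaming (suc to lsuc)
open import Data.Nat as ℕ using (ℕ; zero; suc)
open import Data.Nat.Properties as ℕP using ()
open import Data.Fin using (Fin; zero; suc; toℕ; fromℕ)
open import Data.Fin.Properties using (toℕ-injective; toℕ-fromℕ; toℕ≤pred[n])
open import Data.Bool using (Bool; true; false)
open import Data.Product using (Σ; ∃; _×_; _,_; proj₁; proj₂)
open import Data.Sum using (_⊎_; inj₁; inj₂)
open import Data.Empty using (⊥; ⊥-elim)
open import Function using (_∘_)
open import Relation.Nullary using (¬_)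
open import Relation.Binary.Structures using (IsEquivalence)
open import Relation.Binary.PropositionalEquality as ≡ using (_≡_; _≢_)
open import Relation.Binary.Construct.Closure.Equivalence as EqC using (EqClosure)
import Relation.Binary.Construct.On as On

-- Since quotients do not exist in (safe, non-cubical) Agda, the
-- vertex set of a graph is a setoid (V , _≈_); "equal vertices" always
-- means _≈_.

record Graph (ℓ : Level) : Set (lsuc ℓ) where
  field
    V       : Set ℓ
    _≈_     : V → V → Set ℓ
    ≈-equiv : IsEquivalence _≈_
    E       : V → V → Set ℓ
    E-resp  : ∀ {x x′ y y′} → x ≈ x′ → y ≈ y′ → E x y → E x′ y′
    E-sym   : ∀ {x y} → E x y → E y x
    E-irr   : ∀ {x y} → x ≈ y → ¬ E x y
  open IsEquivalence ≈-equiv public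
    renaming (refl to ≈-refl; sym to ≈-sym; trans to ≈-trans)

  Near : V → V → Set ℓ
  Near x y = x ≈ y ⊎ E x y

  Near-sym : ∀ {x y} → Near x y → Near y x
  Near-sym (inj₁ p) = inj₁ (≈-sym p)
  Near-sym (inj₂ e) = inj₂ (E-sym e)

  Near-respˡ : ∀ {x x′ y} → x ≈ x′ → Near x y → Near x′ y
  Near-respˡ p (inj₁ q) = inj₁ (≈-trans (≈-sym p) q)
  Near-respˡ p (inj₂ e) = inj₂ (E-resp p ≈-refl e)

  Near-respʳ : ∀ {x y y′} → y ≈ y′ → Near x y → Near x y′
  Near-respʳ p (inj₁ q) = inj₁ (≈-trans q p)
  Near-respʳ p (inj₂ e) = inj₂ (E-resp ≈-refl p e)


record GraphMap {a b} (G : Graph a) (H : Graph b) : Set (a ⊔ b) where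
  constructor graphMap
  private
    module G = Graph G
    module H = Graph H
  field
    fun  : G.V → H.V
    cong : ∀ {x y} → x G.≈ y → fun x H.≈ fun y
    adj  : ∀ {x y} → G.E x y → H.Near (fun x) (fun y)

open GraphMap public using (fun)

_∘G_ : ∀ {a b c} {G : Graph a} {H : Graph b} {K : Graph c} →
       GraphMap H K → GraphMap G H → GraphMap G K
_∘G_ {G = G} {K = K} f g = graphMap (fun f ∘ fun g) (GraphMap.cong f ∘ GraphMap.cong g) adj′
  where
  adj′ : ∀ {x y} → Graph.E G x y → Graph.Near K (fun f (fun g x)) (fun f (fun g y))
  adj′ e with GraphMap.adj g e
  ... | inj₁ p  = inj₁ (GraphMap.cong f p)
  ... | inj₂ e′ = GraphMap.adj f e′

Succ : ∀ {k} → Fin k → Fin k → Set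
Succ i j = toℕ j ≡ suc (toℕ i)

private
  n≢1+n : ∀ (n : ℕ) → n ≢ suc n
  n≢1+n zero ()
  n≢1+n (suc n) p = n≢1+n n (ℕP.suc-injective p)

I : ℕ → Graph 0ℓ
I n = record
  { V       = Fin (suc n)
  ; _≈_     = _≡_
  ; ≈-equiv = ≡.isEquivalence
  ; E       = λ i j → Succ i j ⊎ Succ j i
  ; E-resp  = λ { ≡.refl ≡.refl e → e }
  ; E-sym   = λ { (inj₁ p) → inj₂ p ; (inj₂ p) → inj₁ p }
  ; E-irr   = λ { {i} ≡.refl (inj₁ p) → n≢1+n (toℕ i) p
                ; {i} ≡.refl (inj₂ p) → n≢1+n (toℕ i) p }
  }

_□_ : ∀ {a} → Graph a → Graph a → Graph a
G □ H = record
  { V       = G.V × H.V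
  ; _≈_     = λ p q → (proj₁ p G.≈ proj₁ q) × (proj₂ p H.≈ proj₂ q)
  ; ≈-equiv = record
      { refl  = G.≈-refl , H.≈-refl
      ; sym   = λ (p , q) → G.≈-sym p , H.≈-sym q
      ; trans = λ (p , q) (p′ , q′) → G.≈-trans p p′ , H.≈-trans q q′ }
  ; E       = λ p q → ((proj₁ p G.≈ proj₁ q) × H.E (proj₂ p) (proj₂ q))
                    ⊎ (G.E (proj₁ p) (proj₁ q) × (proj₂ p H.≈ proj₂ q))
  ; E-resp  = λ { (p , q) (p′ , q′) (inj₁ (r , e)) →
                     inj₁ (G.≈-trans (G.≈-sym p) (G.≈-trans r p′) , H.E-resp q q′ e)
                ; (p , q) (p′ , q′) (inj₂ (e , r)) →
                     inj₂ (G.E-resp p p′ e , H.≈-trans (H.≈-sym q) (H.≈-trans r q′)) }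
  ; E-sym   = λ { (inj₁ (r , e)) → inj₁ (G.≈-sym r , H.E-sym e)
                ; (inj₂ (e , r)) → inj₂ (G.E-sym e , H.≈-sym r) }
  ; E-irr   = λ { (p , q) (inj₁ (r , e)) → H.E-irr q e
                ; (p , q) (inj₂ (e , r)) → G.E-irr p e }
  }
  where
  module G = Graph G
  module H = Graph H

Square : Graph 0ℓ
Square = I 1 □ I 1

module _ {ℓ} (X : Graph ℓ) where
  open Graph X

  Path : ℕ → Set ℓ
  Path n = GraphMap (I n) X

  start : ∀ {n} → Path n → V
  start γ = fun γ zero

  end : ∀ {n} → Path n → V
  end {n} γ = fun γ (fromℕ n)

  const-path : V → Path 0
  const-path x = graphMap (λ _ → x) (λ _ → ≈-refl) (λ _ → inj₁ ≈-refl)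

  Surjective : ∀ {m n} → GraphMap (I m) (I n) → Set
  Surjective {m} {n} s = ∀ (j : Fin (suc n)) → ∃ λ (i : Fin (suc m)) → fun s i ≡ j

  OrderPreserving : ∀ {m n} → GraphMap (I m) (I n) → Set
  OrderPreserving {m} s = ∀ (i j : Fin (suc m)) → toℕ i ℕ.≤ toℕ j → toℕ (fun s i) ℕ.≤ toℕ (fun s j)

  AnyPath : Set ℓ
  AnyPath = Σ ℕ Path

  data HStep : AnyPath → AnyPath → Set ℓ where
    reparam  : ∀ {m n} (γ : Path n) (s : GraphMap (I m) (I n)) →
               Surjective s → OrderPreserving s →
               HStep (m , γ ∘G s) (n , γ)
    adjacent : ∀ {n} (γ γ′ : Path n) →
               start γ ≈ start γ′ → end γ ≈ end γ′ →
               (∀ i → Near (fun γ i) (fun γ′ i)) →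
               HStep (n , γ) (n , γ′)

  -- [γ] = [γ′] : same path component of the quotient
  _≃_ : AnyPath → AnyPath → Set ℓ
  _≃_ = EqClosure HStep

  private
    snoc : ∀ n → (Fin (suc n) → V) → V → Fin (suc (suc n)) → V
    snoc n f a zero = f zero
    snoc zero f a (suc zero) = a
    snoc (suc n) f a (suc i) = snoc n (f ∘ suc) a i

    snoc-adj : ∀ n (f : Fin (suc n) → V) a →
               (∀ i j → Succ i j → Near (f i) (f j)) → Near (f (fromℕ n)) a →
               ∀ i j → Succ i j → Near (snoc n f a i) (snoc n f a j)
    snoc-adj zero f a hf ha zero (suc zero) p = ha
    snoc-adj (suc n) f a hf ha zero (suc zero) p = hf zero (suc zero) ≡.refl
    snoc-adj (suc n) f a hf ha zero (suc (suc j)) ()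
    snoc-adj n f a hf ha zero zero ()
    snoc-adj zero f a hf ha (suc zero) (suc zero) ()
    snoc-adj (suc n) f a hf ha (suc i) (suc j) p =
      snoc-adj n (f ∘ suc) a (λ i′ j′ q → hf (suc i′) (suc j′) (≡.cong suc q)) ha i j
               (ℕP.suc-injective p)
    snoc-adj zero f a hf ha (suc zero) zero ()
    snoc-adj (suc n) f a hf ha (suc i) zero ()

  _∗_ : ∀ {n} (γ : Path n) (e : Path 1) → end γ ≈ start e → Path (suc n)
  _∗_ {n} γ e h = graphMap (snoc n (fun γ) (fun e (suc zero)))
                           (λ { ≡.refl → ≈-refl }) adj′
    where
    hf : ∀ i j → Succ i j → Near (fun γ i) (fun γ j)
    hf i j p = GraphMap.adj γ (inj₁ p)
    ha : Near (fun γ (fromℕ n)) (fun e (suc zero))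
    ha = Near-respˡ (≈-sym h) (GraphMap.adj e (inj₁ ≡.refl))
    adj′ : ∀ {i j} → Graph.E (I (suc n)) i j →
           Near (snoc n (fun γ) (fun e (suc zero)) i) (snoc n (fun γ) (fun e (suc zero)) j)
    adj′ {i} {j} (inj₁ p) = snoc-adj n (fun γ) _ hf ha i j p
    adj′ {i} {j} (inj₂ p) = Near-sym (snoc-adj n (fun γ) _ hf ha j i p)

  private
    snoc-end : ∀ n (f : Fin (suc n) → V) a → snoc n f a (fromℕ (suc n)) ≡ a
    snoc-end zero f a = ≡.refl
    snoc-end (suc n) f a = snoc-end n (f ∘ suc) a

    reparam-end : ∀ {m n} (s : GraphMap (I m) (I n)) → Surjective s → OrderPreserving s →
                  fun s (fromℕ m) ≡ fromℕ n
    reparam-end {m} {n} s su op with su (fromℕ n)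
    ... | i , si≡n = toℕ-injective (≡.trans (ℕP.≤-antisym (toℕ≤pred[n] (fun s (fromℕ m))) n≤) (≡.sym (toℕ-fromℕ n)))
      where
      n≤ : n ℕ.≤ toℕ (fun s (fromℕ m))
      n≤ = ℕP.≤-trans (ℕP.≤-reflexive (≡.trans (≡.sym (toℕ-fromℕ n)) (≡.cong toℕ (≡.sym si≡n))))
                      (op i (fromℕ m) (ℕP.≤-trans (toℕ≤pred[n] i) (ℕP.≤-reflexive (≡.sym (toℕ-fromℕ m)))))

  ∗-end : ∀ {n} (γ : Path n) (e : Path 1) (h : end γ ≈ start e) → end (_∗_ γ e h) ≡ fun e (suc zero)
  ∗-end {n} γ e h = snoc-end n (fun γ) _

  endA : AnyPath → V
  endA (n , γ) = end γ

  ≃-end : ∀ {α β} → α ≃ β → endA α ≈ endA β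
  ≃-end = EqC.gfold ≈-equiv endA step
    where
    step : ∀ {α β} → HStep α β → endA α ≈ endA β
    step (reparam γ s su op) rewrite reparam-end s su op = ≈-refl
    step (adjacent γ γ′ _ h _) = h

module _ {ℓ} (X : Graph ℓ) (x₀ : Graph.V X) where
  open Graph X

  PathFrom : Set ℓ
  PathFrom = Σ (AnyPath X) λ α → start X (proj₂ α) ≈ x₀

  _≃̃_ : PathFrom → PathFrom → Set ℓ
  α ≃̃ β = _≃_ X (proj₁ α) (proj₁ β)

  -- [γ] ∼ [γ ∗ e] for non-constant e of length 1 starting at the end of γ
  -- (edges of a simple graph join distinct vertices)
  Ext : PathFrom → PathFrom → Set ℓ
  Ext α β = Σ ℕ λ n → Σ (Path X n) λ γ → Σ (start X γ ≈ x₀) λ s →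
            Σ (Path X 1) λ e → Σ (end X γ ≈ start X e) λ h →
            (¬ (start X e ≈ end X e)) ×
            (α ≃̃ ((n , γ) , s)) × (β ≃̃ ((suc n , _∗_ X γ e h) , s))

  private
    module ≃E = IsEquivalence (EqC.isEquivalence (HStep X))

  X̃ : Graph ℓ
  X̃ = record
    { V       = PathFrom
    ; _≈_     = _≃̃_
    ; ≈-equiv = On.isEquivalence proj₁ (EqC.isEquivalence (HStep X))
    ; E       = λ α β → (Ext α β ⊎ Ext β α) × ¬ (α ≃̃ β)
    ; E-resp  = λ {α} {α′} {β} {β′} → E-resp′ {α} {α′} {β} {β′}
    ; E-sym   = λ {α} {β} → E-sym′ {α} {β}
    ; E-irr   = λ p (_ , ne) → ne p
    }
    where
    resp1 : ∀ {α α′ β β′} → α ≃̃ α′ → β ≃̃ β′ → Ext α β → Ext α′ β′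
    resp1 {α} {α′} {β} {β′} p q (n , γ , s , e , h , nc , a , b) =
      n , γ , s , e , h , nc , ≃E.trans {proj₁ α′} {proj₁ α} (≃E.sym {proj₁ α} {proj₁ α′} p) a ,
                               ≃E.trans {proj₁ β′} {proj₁ β} (≃E.sym {proj₁ β} {proj₁ β′} q) b
    resp : ∀ {α α′ β β′} → α ≃̃ α′ → β ≃̃ β′ → Ext α β ⊎ Ext β α → Ext α′ β′ ⊎ Ext β′ α′
    resp {α} {α′} {β} {β′} p q (inj₁ x) = inj₁ (resp1 {α} {α′} {β} {β′} p q x)
    resp {α} {α′} {β} {β′} p q (inj₂ x) = inj₂ (resp1 {β} {β′} {α} {α′} q p x)
    EX : PathFrom → PathFrom → Set ℓ
    EX α β = (Ext α β ⊎ Ext β α) × ¬ (α ≃̃ β)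
    E-resp′ : ∀ {α α′ β β′} → α ≃̃ α′ → β ≃̃ β′ → EX α β → EX α′ β′
    E-resp′ {α} {α′} {β} {β′} p q (x , ne) =
      resp {α} {α′} {β} {β′} p q x ,
      λ r → ne (≃E.trans {proj₁ α} {proj₁ α′} {proj₁ β} p
                 (≃E.trans {proj₁ α′} {proj₁ β′} {proj₁ β} r (≃E.sym {proj₁ β} {proj₁ β′} q)))
    E-sym′ : ∀ {α β} → EX α β → EX β α
    E-sym′ {α} {β} (inj₁ x , ne) = inj₂ x , λ r → ne (≃E.sym {proj₁ β} {proj₁ α} r)
    E-sym′ {α} {β} (inj₂ x , ne) = inj₁ x , λ r → ne (≃E.sym {proj₁ β} {proj₁ α} r)

  x̃₀ : PathFrom
  x̃₀ = (0 , const-path X x₀) , ≈-refl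

  p : GraphMap X̃ X
  p = graphMap (λ α → endA X (proj₁ α)) (λ {α} {β} → ≃-end X {proj₁ α} {proj₁ β}) (λ {α} {β} → adj′ {α} {β})
    where
    ext : ∀ {α β} → Ext α β → E (endA X (proj₁ α)) (endA X (proj₁ β))
    ext {α} {β} (n , γ , s , e , h , nc , a , b) with GraphMap.adj e (inj₁ ≡.refl)
    ... | inj₁ c = ⊥-elim (nc c)
    ... | inj₂ c = E-resp (≈-trans (≈-sym h) (≃-end X (≃E.sym {proj₁ α} a)))
                          (≈-trans (≈-reflexive (≡.sym (∗-end X γ e h))) (≃-end X (≃E.sym {proj₁ β} b))) c
      where open IsEquivalence ≈-equiv using () renaming (reflexive to ≈-reflexive)
    adj′ : ∀ {α β} → (Ext α β ⊎ Ext β α) × ¬ (α ≃̃ β) → Near (endA X (proj₁ α)) (endA X (proj₁ β))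
    adj′ {α} {β} (inj₁ x , _) = inj₂ (ext {α} {β} x)
    adj′ {α} {β} (inj₂ x , _) = inj₂ (E-sym (ext {β} {α} x))

module _ {a b} {Y : Graph a} {X : Graph b} where
  private
    module Y = Graph Y
    module X = Graph X

  record IsCovering (q : GraphMap Y X) : Set (a ⊔ b) where
    field
      -- (i) q restricts to a bijection from y together with its neighbours
      --     onto q(y) together with its neighbours
      --     (into: automatic since q is a graph map)
      local-injective  : ∀ y y₁ y₂ → Y.Near y y₁ → Y.Near y y₂ →
                         fun q y₁ X.≈ fun q y₂ → y₁ Y.≈ y₂
      local-surjective : ∀ y x → X.Near (fun q y) x →
                         ∃ λ y′ → Y.Near y y′ × (fun q y′ X.≈ x)
      square : ∀ (u : GraphMap (I 3) Y) (v : GraphMap Square X) →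
               fun q (fun u zero)                   X.≈ fun v (suc zero , zero) →
               fun q (fun u (suc zero))             X.≈ fun v (zero , zero) →
               fun q (fun u (suc (suc zero)))       X.≈ fun v (zero , suc zero) →
               fun q (fun u (suc (suc (suc zero)))) X.≈ fun v (suc zero , suc zero) →
               Y.Near (fun u zero) (fun u (suc (suc (suc zero))))

record PointedCovering {ℓ} ℓ′ (X : Graph ℓ) (x₀ : Graph.V X) : Set (lsuc ℓ′ ⊔ ℓ) where
  field
    Y        : Graph ℓ′
    y₀       : Graph.V Y
    q        : GraphMap Y X
    covering : IsCovering q
    pointed  : Graph._≈_ X (fun q y₀) x₀

record CovMorphism {ℓ ℓ₁ ℓ₂} {X : Graph ℓ} {x₀ : Graph.V X}
                   (C : PointedCovering ℓ₁ X x₀) (D : PointedCovering ℓ₂ X x₀)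
                   : Set (ℓ ⊔ ℓ₁ ⊔ ℓ₂) where
  private
    module C = PointedCovering C
    module D = PointedCovering D
  field
    f        : GraphMap C.Y D.Y
    pointed  : Graph._≈_ D.Y (fun f C.y₀) D.y₀
    over     : ∀ y → Graph._≈_ X (fun D.q (fun f y)) (fun C.q y)

_≈M_ : ∀ {ℓ ℓ₁ ℓ₂} {X : Graph ℓ} {x₀ : Graph.V X}
       {C : PointedCovering ℓ₁ X x₀} {D : PointedCovering ℓ₂ X x₀} →
       CovMorphism C D → CovMorphism C D → Set (ℓ₁ ⊔ ℓ₂)
_≈M_ {D = D} g h = ∀ y → Graph._≈_ (PointedCovering.Y D)
                           (fun (CovMorphism.f g) y) (fun (CovMorphism.f h) y)

-- a universal cover is an initial object of Cov(X , x₀)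
-- (tested against all pointed coverings whose graph lives at level ℓ′)
IsInitial : ∀ {ℓ ℓ₁} ℓ′ {X : Graph ℓ} {x₀ : Graph.V X} → PointedCovering ℓ₁ X x₀ → Set (lsuc ℓ′ ⊔ ℓ ⊔ ℓ₁)
IsInitial ℓ′ {X} {x₀} C =
  (D : PointedCovering ℓ′ X x₀) →
  Σ (CovMorphism C D) λ g → ∀ (h : CovMorphism C D) → h ≈M g

IsUniversalCover : ∀ {ℓ} ℓ′ (X : Graph ℓ) (x₀ : Graph.V X) → Set (lsuc ℓ′ ⊔ ℓ)
IsUniversalCover ℓ′ X x₀ =
  Σ (IsCovering (p X x₀)) λ cov →
  IsInitial ℓ′ {X} {x₀} (record { Y = X̃ X x₀ ; y₀ = x̃₀ X x₀ ; q = p X x₀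
                                ; covering = cov ; pointed = Graph.≈-refl X })

-- Every X̃-neighbour of [γ] is homotopic to γ extended by one edge (extending and
-- then backtracking is homotopic to γ), so p is bijective on closed neighbourhoods,
-- and a 3-walk in X̃ lying over a square is homotopic, through degenerate squares,
-- to the one-edge extension along the diagonal: this is the square condition.
-- Along any covering q : Y → X paths lift uniquely; by the square condition lifts of
-- adjacent paths stay adjacent, so by local injectivity homotopic paths have lifts
-- with the same end. Hence [γ] ↦ end of the lift of γ from y₀ is a morphism, and any
-- morphism agrees with it, by induction on the length of γ and local injectivity.

module Submission where

open import Defs
open import Level using (Level)
open import Data.Nat as ℕ using (zero; suc; z≤n)
import Data.Nat.Properties as ℕP
open import Data.Fin using (Fin; zero; suc; toℕ; fromℕ; inject₁; pinch)
open import Data.Fin.Properties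
  using (toℕ-injective; toℕ-fromℕ; toℕ-inject₁; ≤fromℕ; inject₁ℕ<; pinch-surjective; pinch-mono-≤)
open import Data.Fin.Relation.Unary.Top using (view; ‵fromℕ; ‵inject₁)
open import Data.Product using (∃; _×_; _,_; proj₁; proj₂)
open import Data.Sum using (_⊎_; inj₁; inj₂)
open import Data.Empty using (⊥-elim)
open import Function using (_∘_)
open import Relation.Binary.PropositionalEquality as ≡ using (_≡_)
open import Relation.Binary.Structures using (IsEquivalence)
open import Relation.Binary.Construct.Closure.Equivalence as EqC using ()
import Relation.Binary.Reasoning.Setoid as SetoidReasoning
open import Relation.Binary.Construct.Closure.Symmetric using (fwd; bwd)
open import Relation.Binary.Construct.Closure.ReflexiveTransitive using (ε; _◅_)

snoc : ∀ {a} {A : Set a} m → (Fin (suc m) → A) → A → Fin (suc (suc m)) → A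
snoc m f a zero = f zero
snoc zero f a (suc zero) = a
snoc (suc m) f a (suc i) = snoc m (f ∘ suc) a i

snoc-inject₁ : ∀ {a} {A : Set a} m (f : Fin (suc m) → A) x j → snoc m f x (inject₁ j) ≡ f j
snoc-inject₁ m f x zero = ≡.refl
snoc-inject₁ (suc m) f x (suc j) = snoc-inject₁ m (f ∘ suc) x j

snoc-last : ∀ {a} {A : Set a} m (f : Fin (suc m) → A) x → snoc m f x (fromℕ (suc m)) ≡ x
snoc-last zero f x = ≡.refl
snoc-last (suc m) f x = snoc-last m (f ∘ suc) x

Succ-inject₁ : ∀ {n} {i j : Fin n} → Succ i j → Succ (inject₁ i) (inject₁ j)
Succ-inject₁ {i = i} {j} p = ≡.trans (toℕ-inject₁ j) (≡.trans p (≡.cong suc (≡.sym (toℕ-inject₁ i))))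

Succ-last : ∀ n → Succ (inject₁ (fromℕ n)) (fromℕ (suc n))
Succ-last n = ≡.cong suc (≡.sym (toℕ-inject₁ (fromℕ n)))

pinch-inject₁ : ∀ n (j : Fin (suc n)) → pinch (fromℕ n) (inject₁ j) ≡ j
pinch-inject₁ n zero = ≡.refl
pinch-inject₁ (suc n) (suc j) = ≡.cong suc (pinch-inject₁ n j)

pinch-last : ∀ n → pinch (fromℕ n) (fromℕ (suc n)) ≡ fromℕ n
pinch-last zero = ≡.refl
pinch-last (suc n) = ≡.cong suc (pinch-last n)

pinch-Succ : ∀ {n} (i : Fin (suc n)) {j k : Fin (suc (suc n))} →
             Succ j k → pinch i j ≡ pinch i k ⊎ Succ (pinch i j) (pinch i k)
pinch-Succ zero {zero} {suc zero} p = inj₁ ≡.refl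
pinch-Succ {suc n} (suc i) {zero} {suc zero} p = inj₂ ≡.refl
pinch-Succ zero {suc j} {suc k} p = inj₂ (ℕP.suc-injective p)
pinch-Succ {suc n} (suc i) {suc j} {suc k} p with pinch-Succ i {j} {k} (ℕP.suc-injective p)
... | inj₁ q = inj₁ (≡.cong suc q)
... | inj₂ q = inj₂ (≡.cong suc q)

module _ {ℓ} (G : Graph ℓ) where
  open Graph G

  IsWalk : ∀ n → (Fin (suc n) → V) → Set ℓ
  IsWalk n f = ∀ (i j : Fin (suc n)) → Succ i j → Near (f i) (f j)

  fromWalk : ∀ {n} (f : Fin (suc n) → V) → IsWalk n f → GraphMap (I n) G
  fromWalk f w = graphMap f (λ { ≡.refl → ≈-refl })
    (λ { {i} {j} (inj₁ p) → w i j p ; {i} {j} (inj₂ p) → Near-sym (w j i p) })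

  walk-tail : ∀ {n} {f : Fin (suc (suc n)) → V} → IsWalk (suc n) f → IsWalk n (f ∘ suc)
  walk-tail w i j p = w (suc i) (suc j) (≡.cong suc p)

  snoc-walk : ∀ m {f : Fin (suc m) → V} {a} → IsWalk m f → Near (f (fromℕ m)) a → IsWalk (suc m) (snoc m f a)
  snoc-walk zero w fa zero (suc zero) _ = fa
  snoc-walk (suc m) w fa zero (suc zero) _ = w zero (suc zero) ≡.refl
  snoc-walk (suc m) w fa (suc i) (suc j) p =
    snoc-walk m (walk-tail w) fa i j (ℕP.suc-injective p)

  walk₃ : ∀ {w x y z} → Near w x → Near x y → Near y z → GraphMap (I 3) G
  walk₃ {w} {x} {y} {z} wx xy yz = fromWalk f v
    where
    f : Fin 4 → V
    f zero = w
    f (suc zero) = x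
    f (suc (suc zero)) = y
    f (suc (suc (suc zero))) = z
    v : IsWalk 3 f
    v zero (suc zero) _ = wx
    v (suc zero) (suc (suc zero)) _ = xy
    v (suc (suc zero)) (suc (suc (suc zero))) _ = yz

  squareMap : ∀ {w x y z} → Near w x → Near w y → Near x z → Near y z → GraphMap Square G
  squareMap {w} {x} {y} {z} wx wy xz yz =
    graphMap corner (λ { (≡.refl , ≡.refl) → ≈-refl })
      (λ { {i , _} (inj₁ (≡.refl , inj₁ p)) → vertical i p
         ; {i , _} (inj₁ (≡.refl , inj₂ p)) → Near-sym (vertical i p)
         ; {_ , j} (inj₂ (inj₁ p , ≡.refl)) → horizontal j p
         ; {_ , j} (inj₂ (inj₂ p , ≡.refl)) → Near-sym (horizontal j p) })
    where
    corner : Fin 2 × Fin 2 → V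
    corner (zero , zero) = w
    corner (suc zero , zero) = x
    corner (zero , suc zero) = y
    corner (suc zero , suc zero) = z
    vertical : ∀ i {j j′} → Succ j j′ → Near (corner (i , j)) (corner (i , j′))
    vertical zero {zero} {suc zero} _ = wy
    vertical (suc zero) {zero} {suc zero} _ = xz
    horizontal : ∀ j {i i′} → Succ i i′ → Near (corner (i , j)) (corner (i′ , j))
    horizontal zero {zero} {suc zero} _ = wx
    horizontal (suc zero) {zero} {suc zero} _ = yz

walk : ∀ {ℓ} {G : Graph ℓ} {n} (γ : GraphMap (I n) G) → IsWalk G n (fun γ)
walk γ i j p = GraphMap.adj γ (inj₁ p)

map-Near : ∀ {a b} {G : Graph a} {H : Graph b} (f : GraphMap G H) {x y} →
           Graph.Near G x y → Graph.Near H (fun f x) (fun f y)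
map-Near f (inj₁ p) = inj₁ (GraphMap.cong f p)
map-Near f (inj₂ e) = GraphMap.adj f e

pinchMap : ∀ n → GraphMap (I (suc n)) (I n)
pinchMap n = fromWalk (I n) (pinch (fromℕ n)) w
  where
  w : IsWalk (I n) (suc n) (pinch (fromℕ n))
  w i j p with pinch-Succ (fromℕ n) p
  ... | inj₁ q = inj₁ q
  ... | inj₂ q = inj₂ (inj₁ q)

inject₁-Near : ∀ {n} {i j : Fin (suc n)} → Graph.Near (I n) i j → Graph.Near (I (suc n)) (inject₁ i) (inject₁ j)
inject₁-Near (inj₁ ≡.refl) = inj₁ ≡.refl
inject₁-Near (inj₂ (inj₁ p)) = inj₂ (inj₁ (Succ-inject₁ p))
inject₁-Near (inj₂ (inj₂ p)) = inj₂ (inj₂ (Succ-inject₁ p))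

module PathHomotopy {ℓ} (X : Graph ℓ) where
  open Graph X
  module ≃ = IsEquivalence (EqC.isEquivalence (HStep X))
  module ≃-Reasoning = SetoidReasoning (EqC.setoid (HStep X))
    using (begin_; step-≈-⟩; step-≈-⟨; _∎)

  ≃-step : ∀ {a b} → HStep X a b → _≃_ X a b
  ≃-step = EqC.return

  tail : ∀ {n} → Path X (suc n) → Path X n
  tail γ = fromWalk X (fun γ ∘ suc) (walk-tail X (walk γ))

  init : ∀ {n} → Path X (suc n) → Path X n
  init γ = fromWalk X (fun γ ∘ inject₁) (λ i j p → walk γ (inject₁ i) (inject₁ j) (Succ-inject₁ p))

  edge : (x y : V) → Near x y → Path X 1
  edge x y xy = fromWalk X f w
    where
    f : Fin 2 → V
    f zero = x
    f (suc zero) = y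
    w : IsWalk X 1 f
    w zero (suc zero) _ = xy

  extend : (a : AnyPath X) (e : Path X 1) → endA X a ≈ start X e → AnyPath X
  extend (n , γ) e h = suc n , _∗_ X γ e h

  extend-end : ∀ a e h → endA X (extend a e h) ≈ end X e
  extend-end (n , γ) e h = reflexive (∗-end X γ e h)

  ∗-inject₁ : ∀ {n} (γ : Path X n) e h j → fun (_∗_ X γ e h) (inject₁ j) ≡ fun γ j
  ∗-inject₁ γ e h zero = ≡.refl
  ∗-inject₁ {suc n} γ e h (suc j) = ∗-inject₁ (tail γ) e h j

  ∗-pointwise : ∀ {r} (R : V → V → Set r) {n} (γ γ′ : Path X n) e e′ h h′ →
                (∀ j → R (fun γ j) (fun γ′ j)) → R (end X e) (end X e′) →
                ∀ i → R (fun (_∗_ X γ e h) i) (fun (_∗_ X γ′ e′ h′) i)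
  ∗-pointwise R γ γ′ e e′ h h′ Rγ Re i with view i
  ... | ‵fromℕ rewrite ∗-end X γ e h | ∗-end X γ′ e′ h′ = Re
  ... | ‵inject₁ j rewrite ∗-inject₁ γ e h j | ∗-inject₁ γ′ e′ h′ j = Rγ j

  ≃-pointwise : ∀ {n} {γ γ′ : Path X n} → (∀ i → fun γ i ≈ fun γ′ i) → _≃_ X (n , γ) (n , γ′)
  ≃-pointwise {n} pt = ≃-step (adjacent _ _ (pt zero) (pt (fromℕ n)) (inj₁ ∘ pt))

  ∗-degenerate : ∀ {n} (γ : Path X n) e h → end X e ≈ end X γ → _≃_ X (suc n , _∗_ X γ e h) (n , γ)
  ∗-degenerate {n} γ e h e≈γ = begin
      suc n , _∗_ X γ e h       ≈⟨ ≃-pointwise ∗≈pinch ⟩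
      suc n , γ ∘G pinchMap n   ≈⟨ ≃-step (reparam γ (pinchMap n) pinch-onto pinch-mono) ⟩
      n , γ                     ∎
    where
    open ≃-Reasoning
    pinch-onto : Surjective X (pinchMap n)
    pinch-onto j = let (i , p) = pinch-surjective (fromℕ n) j in i , p ≡.refl
    pinch-mono : OrderPreserving X (pinchMap n)
    pinch-mono i j = pinch-mono-≤ (fromℕ n) {i} {j}
    ∗≈pinch : ∀ i → fun (_∗_ X γ e h) i ≈ fun γ (pinch (fromℕ n) i)
    ∗≈pinch i with view i
    ... | ‵fromℕ rewrite ∗-end X γ e h | pinch-last n = e≈γ
    ... | ‵inject₁ j rewrite ∗-inject₁ γ e h j | pinch-inject₁ n j = ≈-refl

  Near-refl : ∀ {x} → Near x x
  Near-refl = inj₁ ≈-refl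

  stay : V → Path X 1
  stay x = edge x x Near-refl

  ∗-near : ∀ {n} {γ γ′ : Path X n} {e e′ h h′} → start X γ ≈ start X γ′ →
           (∀ i → Near (fun γ i) (fun γ′ i)) → end X e ≈ end X e′ →
           _≃_ X (suc n , _∗_ X γ e h) (suc n , _∗_ X γ′ e′ h′)
  ∗-near {γ = γ} {γ′} {e} {e′} {h} {h′} s≈ γ∼γ′ e≈e′ = ≃-step (adjacent _ _ s≈ end≈ near)
    where
    end≈ : end X (_∗_ X γ e h) ≈ end X (_∗_ X γ′ e′ h′)
    end≈ = ≈-trans (reflexive (∗-end X γ e h)) (≈-trans e≈e′ (reflexive (≡.sym (∗-end X γ′ e′ h′))))
    near : ∀ i → Near (fun (_∗_ X γ e h) i) (fun (_∗_ X γ′ e′ h′) i)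
    near = ∗-pointwise Near γ γ′ e e′ h h′ γ∼γ′ (inj₁ e≈e′)

  ∗-backtrack : ∀ {n} (γ : Path X n) e h e′ h′ → end X e′ ≈ end X γ →
                _≃_ X (suc (suc n) , _∗_ X (_∗_ X γ e h) e′ h′) (n , γ)
  ∗-backtrack {n} γ e h e′ h′ e′≈γ = begin
      suc (suc n) , _∗_ X (_∗_ X γ e h) e′ h′   ≈⟨ ∗-near ≈-refl γe∼γc e′≈γ ⟩
      suc (suc n) , _∗_ X γc c γc≈c             ≈⟨ ∗-degenerate γc c γc≈c (≈-sym γc≈c) ⟩
      suc n , γc                                ≈⟨ ∗-degenerate γ c ≈-refl ≈-refl ⟩
      n , γ                                     ∎
    where
    open ≃-Reasoning
    c = stay (end X γ)
    γc = _∗_ X γ c ≈-refl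
    γc≈c : end X γc ≈ start X c
    γc≈c = extend-end (n , γ) c ≈-refl
    e-near : Near (end X e) (end X γ)
    e-near = Near-sym (Near-respˡ (≈-sym h) (walk e zero (suc zero) ≡.refl))
    γe∼γc : ∀ i → Near (fun (_∗_ X γ e h) i) (fun γc i)
    γe∼γc = ∗-pointwise Near γ γ e c h ≈-refl (λ _ → Near-refl) e-near

  last-step : ∀ {n} (γ : Path X (suc n)) → Near (fun γ (inject₁ (fromℕ n))) (end X γ)
  last-step {n} γ = walk γ _ _ (Succ-last n)

  ≈-init-∗-last : ∀ {n} (γ : Path X (suc n)) → let e = edge _ _ (last-step γ) in
                  ∀ i → fun γ i ≈ fun (_∗_ X (init γ) e ≈-refl) i
  ≈-init-∗-last γ i with view i
  ... | ‵fromℕ = reflexive (≡.sym (∗-end X (init γ) (edge _ _ (last-step γ)) ≈-refl))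
  ... | ‵inject₁ j = reflexive (≡.sym (∗-inject₁ (init γ) (edge _ _ (last-step γ)) ≈-refl j))

  module Reparametrization {m n} (s : GraphMap (I m) (I n)) (onto : Surjective X s) (mono : OrderPreserving X s) where

    reparam-zero : fun s zero ≡ zero
    reparam-zero = let (i , si≡0) = onto zero in
      toℕ-injective (ℕP.n≤0⇒n≡0 (≡.subst (λ k → toℕ (fun s zero) ℕ.≤ toℕ k) si≡0 (mono zero i z≤n)))

    reparam-last : fun s (fromℕ m) ≡ fromℕ n
    reparam-last = let (i , si≡n) = onto (fromℕ n) in
      toℕ-injective (ℕP.≤-antisym (≤fromℕ (fun s (fromℕ m)))
        (≡.subst (λ k → toℕ k ℕ.≤ toℕ (fun s (fromℕ m))) si≡n (mono i (fromℕ m) (≤fromℕ i))))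

    s⁺ : Fin (suc (suc m)) → Fin (suc (suc n))
    s⁺ = snoc m (inject₁ ∘ fun s) (fromℕ (suc n))

    s⁺-inject₁ : ∀ j → s⁺ (inject₁ j) ≡ inject₁ (fun s j)
    s⁺-inject₁ = snoc-inject₁ m (inject₁ ∘ fun s) (fromℕ (suc n))

    s⁺-last : s⁺ (fromℕ (suc m)) ≡ fromℕ (suc n)
    s⁺-last = snoc-last m (inject₁ ∘ fun s) (fromℕ (suc n))

    extension : GraphMap (I (suc m)) (I (suc n))
    extension = fromWalk (I (suc n)) s⁺ (snoc-walk (I (suc n)) m inject₁-walk last-near)
      where
      inject₁-walk : IsWalk (I (suc n)) m (inject₁ ∘ fun s)
      inject₁-walk i j p = inject₁-Near (walk s i j p)
      last-near : Graph.Near (I (suc n)) (inject₁ (fun s (fromℕ m))) (fromℕ (suc n))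
      last-near rewrite reparam-last = inj₂ (inj₁ (Succ-last n))

    extension-onto : Surjective X extension
    extension-onto j with view j
    ... | ‵fromℕ = fromℕ (suc m) , s⁺-last
    ... | ‵inject₁ j′ = let (i , si≡j′) = onto j′ in inject₁ i , ≡.trans (s⁺-inject₁ i) (≡.cong inject₁ si≡j′)

    extension-mono : OrderPreserving X extension
    extension-mono i j i≤j with view i | view j
    ... | ‵inject₁ i′ | ‵inject₁ j′
      rewrite s⁺-inject₁ i′ | s⁺-inject₁ j′ | toℕ-inject₁ i′ | toℕ-inject₁ j′
            | toℕ-inject₁ (fun s i′) | toℕ-inject₁ (fun s j′) = mono i′ j′ i≤j
    ... | ‵inject₁ i′ | ‵fromℕ
      rewrite s⁺-inject₁ i′ | s⁺-last = ≤fromℕ (inject₁ (fun s i′))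
    ... | ‵fromℕ | ‵inject₁ j′ rewrite toℕ-fromℕ (suc m) = ⊥-elim (ℕP.<⇒≱ (inject₁ℕ< j′) i≤j)
    ... | ‵fromℕ | ‵fromℕ = ℕP.≤-refl

  ≃-start : ∀ {a b} → _≃_ X a b → start X (proj₂ a) ≈ start X (proj₂ b)
  ≃-start = EqC.gfold ≈-equiv (start X ∘ proj₂) step-start
    where
    step-start : ∀ {a b} → HStep X a b → start X (proj₂ a) ≈ start X (proj₂ b)
    step-start (reparam γ s onto mono) = reflexive (≡.cong (fun γ) (Reparametrization.reparam-zero s onto mono))
    step-start (adjacent _ _ s≈ _ _) = s≈

  ∗-cong-step : ∀ {a b} → HStep X a b → ∀ e h h′ → _≃_ X (extend a e h) (extend b e h′)
  ∗-cong-step (reparam {m} {n} γ s onto mono) e h h′ = begin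
      suc m , _∗_ X (γ ∘G s) e h            ≈⟨ ≃-pointwise γs∗e≈γ∗e∘s⁺ ⟩
      suc m , _∗_ X γ e h′ ∘G extension     ≈⟨ ≃-step (reparam _ extension extension-onto extension-mono) ⟩
      suc n , _∗_ X γ e h′                  ∎
    where
    open ≃-Reasoning
    open Reparametrization s onto mono
    γs∗e≈γ∗e∘s⁺ : ∀ i → fun (_∗_ X (γ ∘G s) e h) i ≈ fun (_∗_ X γ e h′) (s⁺ i)
    γs∗e≈γ∗e∘s⁺ i with view i
    ... | ‵inject₁ j rewrite ∗-inject₁ (γ ∘G s) e h j | s⁺-inject₁ j | ∗-inject₁ γ e h′ (fun s j) = ≈-refl
    ... | ‵fromℕ rewrite ∗-end X (γ ∘G s) e h | s⁺-last | ∗-end X γ e h′ = ≈-refl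
  ∗-cong-step (adjacent γ γ′ s≈ _ γ∼γ′) e h h′ = ∗-near s≈ γ∼γ′ ≈-refl

  ∗-cong : ∀ {a b} → _≃_ X a b → ∀ e h h′ → _≃_ X (extend a e h) (extend b e h′)
  ∗-cong ε e h h′ = ≃-pointwise (λ _ → ≈-refl)
  ∗-cong (fwd st ◅ rest) e h h′ =
    ≃.trans (∗-cong-step st e h h″) (∗-cong rest e h″ h′)
    where h″ = ≈-trans (≈-sym (≃-end X (≃-step st))) h
  ∗-cong (bwd st ◅ rest) e h h′ =
    ≃.trans (≃.sym (∗-cong-step st e h″ h)) (∗-cong rest e h″ h′)
    where h″ = ≈-trans (≃-end X (≃-step st)) h

module PathSpaceCovering {ℓ} (X : Graph ℓ) (x₀ : Graph.V X) where
  open Graph X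
  open PathHomotopy X
  private
    module X̃ = Graph (X̃ X x₀)
    π = p X x₀

  extendFrom : (α : PathFrom X x₀) (e : Path X 1) → fun π α ≈ start X e → PathFrom X x₀
  extendFrom (a , s) e h = extend a e h , s

  Near-extendFrom : ∀ α x (πα∼x : Near (fun π α) x) →
                    X̃.Near α (extendFrom α (edge (fun π α) x πα∼x) ≈-refl)
  Near-extendFrom ((n , γ) , s) x (inj₁ πα≈x) = inj₁ (≃.sym (∗-degenerate γ _ ≈-refl (≈-sym πα≈x)))
  Near-extendFrom ((n , γ) , s) x (inj₂ πα—x) =
    inj₂ (inj₁ (n , γ , s , e , ≈-refl , (λ c → E-irr c πα—x) , ε , ε) ,
          λ r → E-irr (≈-trans (≃-end X r) (reflexive (∗-end X γ e ≈-refl))) πα—x)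
    where e = edge (end X γ) x (inj₂ πα—x)

  ≃-extendFrom⇒Near : ∀ α β (πα∼πβ : Near (fun π α) (fun π β)) →
                      _≃_ X (proj₁ β) (extend (proj₁ α) (edge _ _ πα∼πβ) ≈-refl) → X̃.Near α β
  ≃-extendFrom⇒Near α β πα∼πβ β≃αe =
    X̃.Near-respʳ {α} {extendFrom α (edge _ _ πα∼πβ) ≈-refl} {β} (≃.sym β≃αe)
                 (Near-extendFrom α (fun π β) πα∼πβ)

  Near⇒≃-extendFrom : ∀ α β (πα∼πβ : Near (fun π α) (fun π β)) → X̃.Near α β →
                      _≃_ X (proj₁ β) (extend (proj₁ α) (edge _ _ πα∼πβ) ≈-refl)
  Near⇒≃-extendFrom ((n , γ) , _) (b , _) πα∼πβ (inj₁ α≃β) =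
    ≃.trans (≃.sym α≃β) (≃.sym (∗-degenerate γ _ ≈-refl (≈-sym (≃-end X α≃β))))
  Near⇒≃-extendFrom ((n , γ₀) , _) (b , _) πα∼πβ
                    (inj₂ (inj₁ (m , γ , _ , e , h , _ , α≃γ , β≃γe) , _)) = begin
      b                                       ≈⟨ β≃γe ⟩
      suc m , _∗_ X γ e h                     ≈⟨ ∗-cong (≃.sym α≃γ) e h h₀ ⟩
      suc n , _∗_ X γ₀ e h₀                   ≈⟨ ≃-pointwise (∗-pointwise _≈_ γ₀ γ₀ e ed h₀ ≈-refl (λ _ → ≈-refl) e≈β) ⟩
      suc n , _∗_ X γ₀ ed ≈-refl              ∎
    where
    open ≃-Reasoning
    ed = edge (end X γ₀) (endA X b) πα∼πβ
    h₀ = ≈-trans (≃-end X α≃γ) h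
    e≈β = ≈-trans (reflexive (≡.sym (∗-end X γ e h))) (≃-end X (≃.sym β≃γe))
  Near⇒≃-extendFrom ((n , γ₀) , _) (b , _) πα∼πβ
                    (inj₂ (inj₂ (m , γ , _ , e , h , _ , β≃γ , α≃γe) , _)) = begin
      b                                                    ≈⟨ β≃γ ⟩
      m , γ                                                ≈⟨ ∗-backtrack γ e h ed γe≈γ₀ (≃-end X β≃γ) ⟨
      suc (suc m) , _∗_ X (_∗_ X γ e h) ed γe≈γ₀           ≈⟨ ∗-cong (≃.sym α≃γe) ed γe≈γ₀ ≈-refl ⟩
      suc n , _∗_ X γ₀ ed ≈-refl                           ∎
    where
    open ≃-Reasoning
    ed = edge (end X γ₀) (endA X b) πα∼πβ
    γe≈γ₀ = ≃-end X (≃.sym α≃γe)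

  Near-init : ∀ {n} (γ : Path X (suc n)) s → X̃.Near ((n , init γ) , s) ((suc n , γ) , s)
  Near-init {n} γ s =
    ≃-extendFrom⇒Near ((n , init γ) , s) ((suc n , γ) , s) (last-step γ) (≃-pointwise (≈-init-∗-last γ))

  p-local-injective : ∀ α β₁ β₂ → X̃.Near α β₁ → X̃.Near α β₂ → fun π β₁ ≈ fun π β₂ → β₁ X̃.≈ β₂
  p-local-injective α@((n , γ) , _) β₁ β₂ α∼β₁ α∼β₂ πβ₁≈πβ₂ = begin
      proj₁ β₁                   ≈⟨ Near⇒≃-extendFrom α β₁ πα∼πβ₁ α∼β₁ ⟩
      suc n , _∗_ X γ e₁ ≈-refl  ≈⟨ ≃-pointwise (∗-pointwise _≈_ γ γ e₁ e₂ ≈-refl ≈-refl (λ _ → ≈-refl) πβ₁≈πβ₂) ⟩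
      suc n , _∗_ X γ e₂ ≈-refl  ≈⟨ Near⇒≃-extendFrom α β₂ πα∼πβ₂ α∼β₂ ⟨
      proj₁ β₂                   ∎
    where
    open ≃-Reasoning
    πα∼πβ₁ = map-Near π {α} {β₁} α∼β₁
    πα∼πβ₂ = map-Near π {α} {β₂} α∼β₂
    e₁ = edge (end X γ) (fun π β₁) πα∼πβ₁
    e₂ = edge (end X γ) (fun π β₂) πα∼πβ₂

  p-local-surjective : ∀ α x → Near (fun π α) x → ∃ λ β → X̃.Near α β × (fun π β ≈ x)
  p-local-surjective α x πα∼x =
    extendFrom α e ≈-refl , Near-extendFrom α x πα∼x , extend-end (proj₁ α) e ≈-refl
    where e = edge (fun π α) x πα∼x

  -- The lifted 3-walk is homotopic to the lifted diagonal through a degenerate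
  -- square, so of a square in X below the walk only the edge joining the images
  -- of its ends is needed.
  Near-ends-of-3-walk : ∀ α₀ α₁ α₂ α₃ → X̃.Near α₀ α₁ → X̃.Near α₁ α₂ → X̃.Near α₂ α₃ →
                        Near (fun π α₀) (fun π α₃) → X̃.Near α₀ α₃
  Near-ends-of-3-walk α₀ α₁ α₂ α₃ α₀∼α₁ α₁∼α₂ α₂∼α₃ a₀∼a₃ = ≃-extendFrom⇒Near α₀ α₃ a₀∼a₃ (begin
      proj₁ α₃                     ≈⟨ Near⇒≃-extendFrom α₂ α₃ a₂∼a₃ α₂∼α₃ ⟩
      extend (proj₁ α₂) E₃ ≈-refl  ≈⟨ ∗-cong α₂≃P₂ E₃ ≈-refl P₂E₃ ⟩
      extend P₂ E₃ P₂E₃            ≈⟨ ∗-near ≈-refl P₂∼Q₂ ≈-refl ⟩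
      extend Q₂ C′ Q₂C′            ≈⟨ ∗-degenerate (proj₂ Q₂) C′ Q₂C′ (≈-sym Q₂C′) ⟩
      Q₂                           ≈⟨ ∗-near ≈-refl Q₁∼R ≈-refl ⟩
      extend R C′ RC′              ≈⟨ ∗-degenerate (proj₂ R) C′ RC′ (≈-sym RC′) ⟩
      R                            ∎)
    where
    open ≃-Reasoning
    a₀ = proj₁ α₀
    a₀∼a₁ = map-Near π {α₀} {α₁} α₀∼α₁
    a₁∼a₂ = map-Near π {α₁} {α₂} α₁∼α₂
    a₂∼a₃ = map-Near π {α₂} {α₃} α₂∼α₃
    E₁ = edge _ _ a₀∼a₁
    E₂ = edge _ _ a₁∼a₂
    E₃ = edge _ _ a₂∼a₃
    F = edge _ _ a₀∼a₃
    C = stay (fun π α₀)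
    C′ = stay (fun π α₃)
    P₁ = extend a₀ E₁ ≈-refl
    P₁E₂ = extend-end a₀ E₁ ≈-refl
    P₂ = extend P₁ E₂ P₁E₂
    P₂E₃ = extend-end P₁ E₂ P₁E₂
    Q₁ = extend a₀ C ≈-refl
    Q₁F = extend-end a₀ C ≈-refl
    Q₂ = extend Q₁ F Q₁F
    Q₂C′ = extend-end Q₁ F Q₁F
    R = extend a₀ F ≈-refl
    RC′ = extend-end a₀ F ≈-refl
    α₂≃P₂ : _≃_ X (proj₁ α₂) P₂
    α₂≃P₂ = ≃.trans (Near⇒≃-extendFrom α₁ α₂ a₁∼a₂ α₁∼α₂)
                    (∗-cong (Near⇒≃-extendFrom α₀ α₁ a₀∼a₁ α₀∼α₁) E₂ ≈-refl P₁E₂)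
    P₂∼Q₂ = ∗-pointwise Near (proj₂ P₁) (proj₂ Q₁) E₂ F P₁E₂ Q₁F
              (∗-pointwise Near (proj₂ a₀) (proj₂ a₀) E₁ C ≈-refl ≈-refl (λ _ → Near-refl) (Near-sym a₀∼a₁)) a₂∼a₃
    Q₁∼R = ∗-pointwise Near (proj₂ a₀) (proj₂ a₀) C F ≈-refl ≈-refl (λ _ → Near-refl) a₀∼a₃

  p-isCovering : IsCovering π
  p-isCovering = record
    { local-injective  = p-local-injective
    ; local-surjective = p-local-surjective
    ; square           = λ u v πu₀ _ _ πu₃ →
        Near-ends-of-3-walk (fun u zero) (fun u (suc zero)) (fun u (suc (suc zero))) (fun u (suc (suc (suc zero))))
          (walk u zero (suc zero) ≡.refl) (walk u (suc zero) (suc (suc zero)) ≡.refl)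
          (walk u (suc (suc zero)) (suc (suc (suc zero))) ≡.refl)
          (Near-respˡ (≈-sym πu₀) (Near-respʳ (≈-sym πu₃) (GraphMap.adj v (inj₁ (≡.refl , inj₁ ≡.refl)))))
    }

  X̃-pointedCovering : PointedCovering ℓ X x₀
  X̃-pointedCovering = record
    { Y = X̃ X x₀ ; y₀ = x̃₀ X x₀ ; q = π ; covering = p-isCovering ; pointed = ≈-refl }

module PathLifting {ℓ₁ ℓ₂} {Y : Graph ℓ₁} {X : Graph ℓ₂} {q : GraphMap Y X} (cov : IsCovering q) where
  open Graph X
  open PathHomotopy X
  open IsCovering cov
  private
    module Y = Graph Y

  lift-first-step : ∀ {n} (γ : Path X (suc n)) y → fun q y ≈ start X γ →
                    ∃ λ y′ → Y.Near y y′ × (fun q y′ ≈ fun γ (suc zero))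
  lift-first-step γ y qy≈ =
    local-surjective y (fun γ (suc zero)) (Near-respˡ (≈-sym qy≈) (walk γ zero (suc zero) ≡.refl))

  lift : ∀ {n} (γ : Path X n) y → fun q y ≈ start X γ → Fin (suc n) → Y.V
  lift γ y qy≈ zero = y
  lift {suc n} γ y qy≈ (suc i) = let (y′ , _ , qy′≈) = lift-first-step γ y qy≈ in lift (tail γ) y′ qy′≈ i

  lift-over : ∀ {n} (γ : Path X n) y qy≈ i → fun q (lift γ y qy≈ i) ≈ fun γ i
  lift-over γ y qy≈ zero = qy≈
  lift-over {suc n} γ y qy≈ (suc i) = lift-over (tail γ) _ _ i

  lift-walk : ∀ {n} (γ : Path X n) y qy≈ → IsWalk Y n (lift γ y qy≈)
  lift-walk {suc n} γ y qy≈ zero (suc zero) _ = proj₁ (proj₂ (lift-first-step γ y qy≈))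
  lift-walk {suc n} γ y qy≈ (suc i) (suc j) p = lift-walk (tail γ) _ _ i j (ℕP.suc-injective p)

  walks-unique : ∀ {n} {f f′ : Fin (suc n) → Y.V} → IsWalk Y n f → IsWalk Y n f′ →
                 (∀ i → fun q (f i) ≈ fun q (f′ i)) → f zero Y.≈ f′ zero → ∀ i → f i Y.≈ f′ i
  walks-unique w w′ qf≈qf′ f₀≈f′₀ zero = f₀≈f′₀
  walks-unique {suc n} {f} {f′} w w′ qf≈qf′ f₀≈f′₀ (suc i) =
    walks-unique (walk-tail Y w) (walk-tail Y w′) (qf≈qf′ ∘ suc) f₁≈f′₁ i
    where
    f₁≈f′₁ = local-injective (f zero) (f (suc zero)) (f′ (suc zero)) (w zero (suc zero) ≡.refl)
               (Y.Near-respˡ (Y.≈-sym f₀≈f′₀) (w′ zero (suc zero) ≡.refl)) (qf≈qf′ (suc zero))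

  walks-Near : ∀ {n} {f f′ : Fin (suc n) → Y.V} → IsWalk Y n f → IsWalk Y n f′ →
               (∀ i → Near (fun q (f i)) (fun q (f′ i))) → Y.Near (f zero) (f′ zero) →
               ∀ i → Y.Near (f i) (f′ i)
  walks-Near w w′ qf∼qf′ f₀∼f′₀ zero = f₀∼f′₀
  walks-Near {suc n} {f} {f′} w w′ qf∼qf′ f₀∼f′₀ (suc i) =
    walks-Near (walk-tail Y w) (walk-tail Y w′) (qf∼qf′ ∘ suc) f₁∼f′₁ i
    where
    f₁₀ = Y.Near-sym (w zero (suc zero) ≡.refl)
    f′₀₁ = w′ zero (suc zero) ≡.refl
    f₁∼f′₁ = square (walk₃ Y f₁₀ f₀∼f′₀ f′₀₁)
                    (squareMap X (map-Near q (Y.Near-sym f₁₀)) (qf∼qf′ zero) (qf∼qf′ (suc zero)) (map-Near q f′₀₁))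
                    ≈-refl ≈-refl ≈-refl ≈-refl

  liftEnd : ∀ (a : AnyPath X) y → fun q y ≈ start X (proj₂ a) → Y.V
  liftEnd (n , γ) y qy≈ = lift γ y qy≈ (fromℕ n)

  liftEnd-over : ∀ a y qy≈ → fun q (liftEnd a y qy≈) ≈ endA X a
  liftEnd-over (n , γ) y qy≈ = lift-over γ y qy≈ (fromℕ n)

  lift-unique : ∀ {n} (γ : Path X n) y qy≈ {f} → IsWalk Y n f → f zero Y.≈ y →
                (∀ i → fun q (f i) ≈ fun γ i) → ∀ i → f i Y.≈ lift γ y qy≈ i
  lift-unique γ y qy≈ w f₀≈y qf≈γ =
    walks-unique w (lift-walk γ y qy≈) (λ i → ≈-trans (qf≈γ i) (≈-sym (lift-over γ y qy≈ i))) f₀≈y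

  liftEnd-step : ∀ {a b} → HStep X a b → ∀ y qy≈ qy≈′ → liftEnd a y qy≈ Y.≈ liftEnd b y qy≈′
  liftEnd-step (reparam {m} {n} γ s onto mono) y qy≈ qy≈′ =
    Y.≈-trans (Y.≈-sym (lift-unique (γ ∘G s) y qy≈ (walk (L ∘G s)) (Y.reflexive (≡.cong Lγ reparam-zero))
                                    (λ i → lift-over γ y qy≈′ (fun s i)) (fromℕ m)))
              (Y.reflexive (≡.cong Lγ reparam-last))
    where
    open Reparametrization s onto mono
    Lγ = lift γ y qy≈′
    L = fromWalk Y Lγ (lift-walk γ y qy≈′)
  liftEnd-step (adjacent {n} γ γ′ _ end≈ γ∼γ′) y qy≈ qy≈′ =
    local-injective (L (fromℕ n)) (L (fromℕ n)) (L′ (fromℕ n)) (inj₁ Y.≈-refl)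
      (walks-Near (lift-walk γ y qy≈) (lift-walk γ′ y qy≈′) qL∼qL′ (inj₁ Y.≈-refl) (fromℕ n))
      (≈-trans (lift-over γ y qy≈ (fromℕ n)) (≈-trans end≈ (≈-sym (lift-over γ′ y qy≈′ (fromℕ n)))))
    where
    L = lift γ y qy≈
    L′ = lift γ′ y qy≈′
    qL∼qL′ : ∀ i → Near (fun q (L i)) (fun q (L′ i))
    qL∼qL′ i = Near-respˡ (≈-sym (lift-over γ y qy≈ i)) (Near-respʳ (≈-sym (lift-over γ′ y qy≈′ i)) (γ∼γ′ i))

  liftEnd-cong : ∀ {a b} → _≃_ X a b → ∀ y qy≈ qy≈′ → liftEnd a y qy≈ Y.≈ liftEnd b y qy≈′
  liftEnd-cong {n , γ} ε y qy≈ qy≈′ =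
    lift-unique γ y qy≈′ (lift-walk γ y qy≈) Y.≈-refl (lift-over γ y qy≈) (fromℕ n)
  liftEnd-cong (fwd st ◅ rest) y qy≈ qy≈′ =
    Y.≈-trans (liftEnd-step st y qy≈ qy≈″) (liftEnd-cong rest y qy≈″ qy≈′)
    where qy≈″ = ≈-trans qy≈ (≃-start (≃-step st))
  liftEnd-cong (bwd st ◅ rest) y qy≈ qy≈′ =
    Y.≈-trans (Y.≈-sym (liftEnd-step st y qy≈″ qy≈)) (liftEnd-cong rest y qy≈″ qy≈′)
    where qy≈″ = ≈-trans qy≈ (≈-sym (≃-start (≃-step st)))

  liftEnd-extend-Near : ∀ a e h y qy≈ → Y.Near (liftEnd a y qy≈) (liftEnd (extend a e h) y qy≈)
  liftEnd-extend-Near (n , γ) e h y qy≈ =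
    Y.Near-respˡ (L∘inject₁≈ (fromℕ n)) (lift-walk γe y qy≈ (inject₁ (fromℕ n)) (fromℕ (suc n)) (Succ-last n))
    where
    γe = _∗_ X γ e h
    L∘inject₁≈ : ∀ i → lift γe y qy≈ (inject₁ i) Y.≈ lift γ y qy≈ i
    L∘inject₁≈ = lift-unique γ y qy≈ (λ i j p → lift-walk γe y qy≈ (inject₁ i) (inject₁ j) (Succ-inject₁ p))
                   Y.≈-refl (λ i → ≈-trans (lift-over γe y qy≈ (inject₁ i)) (reflexive (∗-inject₁ γ e h i)))

module UniversalProperty {ℓ ℓ′} (X : Graph ℓ) (x₀ : Graph.V X) (D : PointedCovering ℓ′ X x₀) where
  open Graph X
  open PathHomotopy X
  open PathSpaceCovering X x₀
  open PointedCovering D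
  open IsCovering covering
  open PathLifting covering
  private
    module Y = Graph Y

  liftFromBase : PathFrom X x₀ → Y.V
  liftFromBase (a , s) = liftEnd a y₀ (≈-trans pointed (≈-sym s))

  liftMap : GraphMap (X̃ X x₀) Y
  liftMap = graphMap liftFromBase (λ {α} {β} α≃β → liftEnd-cong α≃β y₀ _ _) adj
    where
    adj : ∀ {α β} → Graph.E (X̃ X x₀) α β → Y.Near (liftFromBase α) (liftFromBase β)
    adj {α@(a , s)} {β} α—β =
      Y.Near-respʳ (Y.≈-sym (liftEnd-cong β≃αe y₀ _ _)) (liftEnd-extend-Near a e ≈-refl y₀ _)
      where
      πα∼πβ = GraphMap.adj (p X x₀) {α} {β} α—β
      e = edge _ _ πα∼πβ
      β≃αe = Near⇒≃-extendFrom α β πα∼πβ (inj₂ α—β)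

  liftMorphism : CovMorphism X̃-pointedCovering D
  liftMorphism = record
    { f = liftMap ; pointed = Y.≈-refl ; over = λ (a , s) → liftEnd-over a y₀ _ }

  liftMorphism-unique : ∀ (h : CovMorphism X̃-pointedCovering D) → h ≈M liftMorphism
  liftMorphism-unique h ((n , γ) , s) = h≈lift n γ s
    where
    module h = CovMorphism h
    h≈lift : ∀ n (γ : Path X n) s → fun h.f ((n , γ) , s) Y.≈ liftFromBase ((n , γ) , s)
    h≈lift zero γ s =
      Y.≈-trans (GraphMap.cong h.f {(_ , γ) , s} {x̃₀ X x₀} (≃-pointwise λ { zero → s ; (suc ()) })) h.pointed
    h≈lift (suc n) γ s =
      local-injective (liftFromBase α′) (fun h.f α) (liftFromBase α)
        (Y.Near-respˡ (h≈lift n (init γ) s) (map-Near h.f {α′} {α} α′∼α))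
        (map-Near liftMap {α′} {α} α′∼α)
        (≈-trans (h.over α) (≈-sym (liftEnd-over (suc n , γ) y₀ _)))
      where
      α = (suc n , γ) , s
      α′ = (n , init γ) , s
      α′∼α = Near-init γ s

proposition4p29 : ∀ {ℓ : Level} (ℓ′ : Level) (X : Graph ℓ) (x₀ : Graph.V X) → IsUniversalCover ℓ′ X x₀
proposition4p29 ℓ′ X x₀ =
  p-isCovering , λ D → liftMorphism D , liftMorphism-unique D
  where
  open PathSpaceCovering X x₀ using (p-isCovering)
  open UniversalProperty X x₀ using (liftMorphism; liftMorphism-unique)
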